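{- Let $L_0$ be a logic, $L$ an extension of $L_0$, and $T$ a theory of $L$. Then $T$ is Hilbert-Post complete with respect to $L_0$ if and only if $T$ is consistent and for every formula $e$ of $L$ there is a set $E_0$ of formulas of $L_0$ such that $\{e\}$ is $T$-equivalent to $E_0$.
   Context: A logic consists of a language (a set of formulas) together with deduction rules. A theory is a deductively closed set of formulas. $T_{\max}$ denotes the theory of $L$ consisting of all formulas; $T$ is consistent if $T\neq T_{\max}$. For a set $E$ of formulas, $\mathrm{Th}(E)$ is the theory generated by $E$; for theories $T,T'$, $T+T'$ is the theory generated by $T\cup T'$. $L$ is an extension of $L_0$: formulas of $L_0$ are formulas of $L$. For a theory $T_0$ of $L_0$, $F(T_0)$ is the theory of $L$ generated by $T_0$. A theory $T'$ of $L$ is $L_0$-derivable from $T$ if $T'=T+F(T'_0)$ for some theory $T'_0$ of $L_0$. $T$ is Hilbert-Post complete with respect to $L_0$ if it is consistent and every theory of $L$ containing $T$ is $L_0$-derivable from $T$. Two sets $E_1,E_2$ of formulas are $T$-equivalent if $T+\mathrm{Th}(E_1)=T+\mathrm{Th}(E_2)$. -}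

module Defs where

open import Level using (0ℓ)
open import Data.List using (List)
open import Data.List.Relation.Unary.All using (All)
open import Data.Product using (Σ; ∃; _×_; _,_)
open import Relation.Binary.PropositionalEquality using (_≡_)
open import Relation.Unary using (Pred; _⊆_; _∪_; _≐_; ｛_｝; Universal)
open import Relation.Nullary using (¬_)
open import Function.Definitions using (Injective)
open import Data.List.Membership.Propositional using (_∈_)

record Logic : Set₁ where
  field
    Form    : Set
    Rule    : Set
    premises : Rule → List Form
    concl    : Rule → Form

open Logic public

FSet : Logic → Set₁
FSet L = Pred (Form L) 0ℓ

data Deriv (L : Logic) (E : FSet L) : Form L → Set where
  hyp  : ∀ {φ} → E φ → Deriv L E φ
  rule : (r : Rule L) → All (Deriv L E) (premises L r) → Deriv L E (concl L r)

Th : (L : Logic) → FSet L → FSet L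
Th L E = Deriv L E

IsTheory : (L : Logic) → FSet L → Set
IsTheory L T = ∀ (r : Rule L) → All T (premises L r) → T (concl L r)

Consistent : (L : Logic) → FSet L → Set
Consistent L T = ¬ (Universal T)


record Extension (L0 L : Logic) : Set where
  field
    ι          : Form L0 → Form L
    ι-injective : Injective _≡_ _≡_ ι
    ι-rules    : ∀ (r : Rule L0) →
                 Deriv L (λ φ → ∃ λ ψ → (ψ ∈ premises L0 r) × ι ψ ≡ φ) (ι (concl L0 r))

open Extension public

module _ {L0 L : Logic} (X : Extension L0 L) where

  image : FSet L0 → FSet L
  image E0 φ = ∃ λ ψ → E0 ψ × ι X ψ ≡ φ

  F : FSet L0 → FSet L
  F T0 = Th L (image T0)

  L0-Derivable : FSet L → FSet L → Set₁
  L0-Derivable T T' = Σ (FSet L0) λ T0' → IsTheory L0 T0' × (T' ≐ Th L (T ∪ F T0'))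

  HilbertPostComplete : FSet L → Set₁
  HilbertPostComplete T =
    Consistent L T ×
    (∀ (T' : FSet L) → IsTheory L T' → T ⊆ T' → L0-Derivable T T')

TEquivalent : (L : Logic) → FSet L → FSet L → FSet L → Set
TEquivalent L T E1 E2 = Th L (T ∪ Th L E1) ≐ Th L (T ∪ Th L E2)

-- For a theory T' ⊇ T take T'₀ = ι⁻¹(T'), which is a theory of L0. Then T' = T + F(T'₀):
-- each e ∈ T' is T-equivalent to a set E0 of L0-formulas, which are derivable from
-- T + Th{e} ⊆ T' and hence lie in T'₀, so e is derivable from T + F(T'₀). Conversely,
-- L0-derivability of T + Th{e} provides the set E0 directly.
module Submission where

open import Defs
open import Data.Product using (Σ; _×_; _,_; proj₁)
open import Data.Sum using (inj₁; inj₂)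
open import Data.List.Relation.Unary.All using (All; []; _∷_; lookup)
open import Relation.Binary.PropositionalEquality using (refl)
open import Relation.Unary using (｛_｝; _⊆_; _∪_)
open import Function.Bundles using (_⇔_; mk⇔)

module _ {L : Logic} where

  Th-isTheory : (E : FSet L) → IsTheory L (Th L E)
  Th-isTheory E = rule

  mutual
    Th-minimal : {E T : FSet L} → IsTheory L T → E ⊆ T → Th L E ⊆ T
    Th-minimal thT E⊆T (hyp e)     = E⊆T e
    Th-minimal thT E⊆T (rule r ds) = thT r (All-Th-minimal thT E⊆T ds)

    All-Th-minimal : {E T : FSet L} → IsTheory L T → E ⊆ T → ∀ {xs} → All (Th L E) xs → All T xs
    All-Th-minimal thT E⊆T []       = []
    All-Th-minimal thT E⊆T (d ∷ ds) = Th-minimal thT E⊆T d ∷ All-Th-minimal thT E⊆T ds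

  Th-monotone : {E E' : FSet L} → E ⊆ E' → Th L E ⊆ Th L E'
  Th-monotone E⊆E' = Th-minimal (Th-isTheory _) (λ e → hyp (E⊆E' e))

  +-minimal : {T E T' : FSet L} → IsTheory L T' → T ⊆ T' → E ⊆ T' → Th L (T ∪ Th L E) ⊆ T'
  +-minimal thT' T⊆T' E⊆T' = Th-minimal thT' λ
    { (inj₁ t) → T⊆T' t
    ; (inj₂ d) → Th-minimal thT' E⊆T' d
    }

  +-monotoneʳ : {T E E' : FSet L} → E ⊆ E' → Th L (T ∪ Th L E) ⊆ Th L (T ∪ Th L E')
  +-monotoneʳ E⊆E' = Th-monotone λ
    { (inj₁ t) → inj₁ t
    ; (inj₂ d) → inj₂ (Th-monotone E⊆E' d)
    }

  ⊆-+ : {T E : FSet L} → E ⊆ Th L (T ∪ Th L E)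
  ⊆-+ e = hyp (inj₂ (hyp e))

  TEquivalent-⊆ : {T E₁ E₂ : FSet L} → TEquivalent L T E₁ E₂ → E₂ ⊆ Th L (T ∪ Th L E₁)
  TEquivalent-⊆ (_ , E₂⊆E₁) e = E₂⊆E₁ (⊆-+ e)

module _ {L0 L : Logic} (X : Extension L0 L) where

  preimage : FSet L → FSet L0
  preimage T ψ = T (ι X ψ)

  preimage-isTheory : {T : FSet L} → IsTheory L T → IsTheory L0 (preimage T)
  preimage-isTheory thT r ps = Th-minimal thT (λ { (ψ , m , refl) → lookup ps m }) (ι-rules X r)

  image-preimage-⊆ : {T : FSet L} → image X (preimage T) ⊆ T
  image-preimage-⊆ (ψ , t , refl) = t

  image-⊆⇒⊆-preimage : {E0 : FSet L0} {T : FSet L} → image X E0 ⊆ T → E0 ⊆ preimage T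
  image-⊆⇒⊆-preimage E0⊆T {ψ} e = E0⊆T (ψ , e , refl)

  image-monotone : {E0 E0' : FSet L0} → E0 ⊆ E0' → image X E0 ⊆ image X E0'
  image-monotone E0⊆E0' (ψ , e , refl) = ψ , E0⊆E0' e , refl

  L0-Reducible : FSet L → Set₁
  L0-Reducible T = ∀ (e : Form L) → Σ (FSet L0) λ E0 → TEquivalent L T ｛ e ｝ (image X E0)

  module _ {T : FSet L} (reduce : L0-Reducible T)
           {T' : FSet L} (thT' : IsTheory L T') (T⊆T' : T ⊆ T') where

    ⊆-+-F-preimage : T' ⊆ Th L (T ∪ F X (preimage T'))
    ⊆-+-F-preimage {e} e∈T' with reduce e
    ... | E0 , equiv = +-monotoneʳ (image-monotone E0⊆T'₀) (proj₁ equiv (⊆-+ refl))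
      where
      E0⊆T'₀ : E0 ⊆ preimage T'
      E0⊆T'₀ = image-⊆⇒⊆-preimage λ x →
        +-minimal thT' T⊆T' (λ { refl → e∈T' }) (TEquivalent-⊆ equiv x)

    L0-Derivable-preimage : L0-Derivable X T T'
    L0-Derivable-preimage =
      preimage T' , preimage-isTheory thT' ,
      ⊆-+-F-preimage , +-minimal thT' T⊆T' image-preimage-⊆

corollary2p10 : (L0 L : Logic) (X : Extension L0 L) (T : FSet L) → IsTheory L T →
    HilbertPostComplete X T ⇔
      (Consistent L T × (∀ (e : Form L) → Σ (FSet L0) λ E0 → TEquivalent L T ｛ e ｝ (image X E0)))
-- The argument never uses that T itself is deductively closed.
corollary2p10 L0 L X T _ = mk⇔ complete⇒reducible reducible⇒complete
  where
  complete⇒reducible : HilbertPostComplete X T → Consistent L T × L0-Reducible X T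
  complete⇒reducible (con , derivable) = con , λ e →
    let (T0 , _ , T+e≐T+FT0) = derivable (Th L (T ∪ Th L ｛ e ｝)) (Th-isTheory _) (λ t → hyp (inj₁ t))
    in T0 , T+e≐T+FT0

  reducible⇒complete : Consistent L T × L0-Reducible X T → HilbertPostComplete X T
  reducible⇒complete (con , reduce) = con , λ _ thT' T⊆T' → L0-Derivable-preimage X reduce thT' T⊆T'
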